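{- For all terms $M,N$ of the (restricted) call-by-value $\lambda\Box$-calculus (which contain no let), $M=_vN$ holds if and only if $M=_cN$ holds.
   Context: Types: $\sigma::=p\mid\sigma\supset\sigma\mid\Box\sigma$. Restricted call-by-value terms: $M::=c\mid x\mid\lambda x^\sigma.M\mid MM\mid\mathbf{box}_{x_1,\dots,x_n}(M_1,\dots,M_n;V)$. The $x_i$ are bound in the body, and the free variables of a box term are those of the $M_i$. Computational terms additionally include $\mathrm{let}\ x=N\ \mathrm{in}\ M$ ($x$ bound in $M$). Values: $V::=c\mid x\mid\lambda x.M\mid\mathbf{box}_{\vec x}(V_1,\dots,V_n;M)$; a non-value is a term that is not a value. Simple evaluation contexts: $C::=[\,]M\mid V[\,]\mid\mathbf{box}_{\vec x}(V_1,\dots,V_k,[\,],M_1,\dots,M_m;M)$. Evaluation contexts: $E::=[\,]\mid C[E]$. $\to_v$ is the closure under term contexts of the following rules ($y$ a variable, new bound variables fresh): - $(\lambda x.x)M\to M$; - $(\lambda x.M)V\to M[x:=V]$; - $\lambda x.Vx\to V$ ($x\notin FV(V)$); - $C[(\lambda x.M)N]\to(\lambda x.C[M])N$; - $C[yM]\to(\lambda x.C[x])(yM)$ if $C$ is not of the form $V[\,]$; - $(\lambda x.E[yx])M\to E[yM]$ if $x\notin FV(E[y])$; - $\mathbf{box}_x(M;x)\to M$; - $\mathbf{box}_{\vec w,x,\vec z}(\vec W,\mathbf{box}_{\vec y}(\vec N;V),\vec P;M)\to\mathbf{box}_{\vec w,\vec y,\vec z}(\vec W,\vec N,\vec P;M[x:=V])$,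 $\vec W$ values, $|\vec w|=|\vec W|$. $\to_c$ (on computational terms) is the closure under term contexts of: - $\mathrm{let}\ x=M\ \mathrm{in}\ x\to M$; - $\mathrm{let}\ x=V\ \mathrm{in}\ M\to M[x:=V]$; - $(\lambda x.M)V\to M[x:=V]$; - $\lambda x.Vx\to V$ ($x\notin FV(V)$); - $\mathrm{let}\ x=(\mathrm{let}\ y=L\ \mathrm{in}\ N)\ \mathrm{in}\ M\to\mathrm{let}\ y=L\ \mathrm{in}\ \mathrm{let}\ x=N\ \mathrm{in}\ M$ ($y\notin FV(M)$); - $C[A]\to\mathrm{let}\ x=A\ \mathrm{in}\ C[x]$ for $A$ a non-value; - the two box rules above. $=_v$ and $=_c$ are the reflexive, symmetric, transitive closures of $\to_v$ and $\to_c$ (with $=_c$ ranging over computational terms). -}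

module Defs where

open import Data.Bool using (Bool; true; false)
open import Data.Nat using (ℕ)
open import Data.List using (List; []; _∷_; _++_)
open import Data.Empty using (⊥)
open import Data.Unit using (⊤)
open import Relation.Nullary using (¬_)
open import Relation.Binary.Construct.Closure.Equivalence using (EqClosure)

infixr 7 _⊃_
data Ty : Set where
  base : ℕ → Ty
  _⊃_  : Ty → Ty → Ty
  □    : Ty → Ty

Ctx : Set
Ctx = List Ty

infix 4 _∋_
data _∋_ : Ctx → Ty → Set where
  here  : ∀ {Γ σ} → (σ ∷ Γ) ∋ σ
  there : ∀ {Γ σ τ} → Γ ∋ σ → (τ ∷ Γ) ∋ σ

-- The Bool index says whether `let` is allowed:
--   Tm false : the restricted call-by-value terms (no let)
--   Tm true  : the computational terms.
-- box_{x1..xn}(M1..Mn; M) : the body M lives in the context x1:σ1..xn:σn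
-- ONLY (the free variables of a box are those of the Mi).

mutual
  data Tm : Bool → Ctx → Ty → Set where
    con  : ∀ {b Γ σ} → ℕ → Tm b Γ σ
    var  : ∀ {b Γ σ} → Γ ∋ σ → Tm b Γ σ
    lam  : ∀ {b Γ σ τ} → Tm b (σ ∷ Γ) τ → Tm b Γ (σ ⊃ τ)
    app  : ∀ {b Γ σ τ} → Tm b Γ (σ ⊃ τ) → Tm b Γ σ → Tm b Γ τ
    box  : ∀ {b Γ Δ τ} → Args b Γ Δ → Tm b Δ τ → Tm b Γ (□ τ)
    lett : ∀ {Γ σ τ} → Tm true Γ σ → Tm true (σ ∷ Γ) τ → Tm true Γ τ

  data Args : Bool → Ctx → Ctx → Set where
    []  : ∀ {b Γ} → Args b Γ []
    _∷_ : ∀ {b Γ σ Δ} → Tm b Γ (□ σ) → Args b Γ Δ → Args b Γ (σ ∷ Δ)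

infixr 5 _++A_
_++A_ : ∀ {b Γ Δ₁ Δ₂} → Args b Γ Δ₁ → Args b Γ Δ₂ → Args b Γ (Δ₁ ++ Δ₂)
[] ++A bs = bs
(a ∷ as) ++A bs = a ∷ (as ++A bs)

mutual
  emb : ∀ {Γ σ} → Tm false Γ σ → Tm true Γ σ
  emb (con c) = con c
  emb (var x) = var x
  emb (lam M) = lam (emb M)
  emb (app M N) = app (emb M) (emb N)
  emb (box as M) = box (embArgs as) (emb M)

  embArgs : ∀ {Γ Δ} → Args false Γ Δ → Args true Γ Δ
  embArgs [] = []
  embArgs (a ∷ as) = emb a ∷ embArgs as

Ren : Ctx → Ctx → Set
Ren Γ Δ = ∀ {σ} → Γ ∋ σ → Δ ∋ σ

ext : ∀ {Γ Δ τ} → Ren Γ Δ → Ren (τ ∷ Γ) (τ ∷ Δ)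
ext ρ here = here
ext ρ (there x) = there (ρ x)

mutual
  ren : ∀ {b Γ Δ σ} → Ren Γ Δ → Tm b Γ σ → Tm b Δ σ
  ren ρ (con c) = con c
  ren ρ (var x) = var (ρ x)
  ren ρ (lam M) = lam (ren (ext ρ) M)
  ren ρ (app M N) = app (ren ρ M) (ren ρ N)
  ren ρ (box as M) = box (renArgs ρ as) M
  ren ρ (lett M N) = lett (ren ρ M) (ren (ext ρ) N)

  renArgs : ∀ {b Γ Δ Θ} → Ren Γ Δ → Args b Γ Θ → Args b Δ Θ
  renArgs ρ [] = []
  renArgs ρ (a ∷ as) = ren ρ a ∷ renArgs ρ as

wk : ∀ {b Γ σ τ} → Tm b Γ σ → Tm b (τ ∷ Γ) σ
wk = ren there

Sub : Bool → Ctx → Ctx → Set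
Sub b Γ Δ = ∀ {σ} → Γ ∋ σ → Tm b Δ σ

exts : ∀ {b Γ Δ τ} → Sub b Γ Δ → Sub b (τ ∷ Γ) (τ ∷ Δ)
exts s here = var here
exts s (there x) = wk (s x)

mutual
  sub : ∀ {b Γ Δ σ} → Sub b Γ Δ → Tm b Γ σ → Tm b Δ σ
  sub s (con c) = con c
  sub s (var x) = s x
  sub s (lam M) = lam (sub (exts s) M)
  sub s (app M N) = app (sub s M) (sub s N)
  sub s (box as M) = box (subArgs s as) M
  sub s (lett M N) = lett (sub s M) (sub (exts s) N)

  subArgs : ∀ {b Γ Δ Θ} → Sub b Γ Δ → Args b Γ Θ → Args b Δ Θ
  subArgs s [] = []
  subArgs s (a ∷ as) = sub s a ∷ subArgs s as

sub0 : ∀ {b Γ σ} → Tm b Γ σ → Sub b (σ ∷ Γ) Γ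
sub0 V here = V
sub0 V (there x) = var x

_[_] : ∀ {b Γ σ τ} → Tm b (σ ∷ Γ) τ → Tm b Γ σ → Tm b Γ τ
M [ V ] = sub (sub0 V) M

inl : ∀ {Γ Δ σ} → Γ ∋ σ → (Γ ++ Δ) ∋ σ
inl here = here
inl (there x) = there (inl x)

inr : ∀ Γ {Δ σ} → Δ ∋ σ → (Γ ++ Δ) ∋ σ
inr [] x = x
inr (_ ∷ Γ) x = there (inr Γ x)

-- the substitution  x := V  used in the box-merging rule:
-- body context  w ++ x ∷ z   ↦   w ++ y ++ z   (V lives in context y)
subBox : ∀ {b} Δw {Δy Δz τ} → Tm b Δy τ →
         Sub b (Δw ++ τ ∷ Δz) (Δw ++ Δy ++ Δz)
subBox [] V here = ren inl V
subBox [] {Δy} V (there x) = var (inr Δy x)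
subBox (_ ∷ Δw) V here = var here
subBox (_ ∷ Δw) V (there x) = wk (subBox Δw V x)

mutual
  data Val {b Γ} : ∀ {σ} → Tm b Γ σ → Set where
    vcon : ∀ {σ} {c : ℕ} → Val (con {b} {Γ} {σ} c)
    vvar : ∀ {σ} {x : Γ ∋ σ} → Val (var {b} x)
    vlam : ∀ {σ τ} {M : Tm b (σ ∷ Γ) τ} → Val (lam M)
    vbox : ∀ {Δ τ} {as : Args b Γ Δ} {M : Tm b Δ τ} → AllVal as → Val (box as M)

  data AllVal {b Γ} : ∀ {Δ} → Args b Γ Δ → Set where
    []  : AllVal []
    _∷_ : ∀ {σ Δ} {a : Tm b Γ (□ σ)} {as : Args b Γ Δ} → Val a → AllVal as → AllVal (a ∷ as)

mutual
  renVal : ∀ {b Γ Δ σ} (ρ : Ren Γ Δ) {V : Tm b Γ σ} → Val V → Val (ren ρ V)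
  renVal ρ vcon = vcon
  renVal ρ vvar = vvar
  renVal ρ vlam = vlam
  renVal ρ (vbox vs) = vbox (renAllVal ρ vs)

  renAllVal : ∀ {b Γ Δ Θ} (ρ : Ren Γ Δ) {as : Args b Γ Θ} → AllVal as → AllVal (renArgs ρ as)
  renAllVal ρ [] = []
  renAllVal ρ (v ∷ vs) = renVal ρ v ∷ renAllVal ρ vs

-- Simple evaluation contexts  C ::= [ ]M | V[ ] | box(V1..Vk,[ ],M1..Mm; M)
-- Frame b Γ σ τ : hole of type σ, result of type τ.

data Frame (b : Bool) (Γ : Ctx) : Ty → Ty → Set where
  appL : ∀ {σ τ} → Tm b Γ σ → Frame b Γ (σ ⊃ τ) τ
  appR : ∀ {σ τ} (V : Tm b Γ (σ ⊃ τ)) → Val V → Frame b Γ σ τ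
  boxH : ∀ {Δw Δz σ τ} (Ws : Args b Γ Δw) → AllVal Ws → Args b Γ Δz →
         Tm b (Δw ++ σ ∷ Δz) τ → Frame b Γ (□ σ) (□ τ)

plug : ∀ {b Γ σ τ} → Frame b Γ σ τ → Tm b Γ σ → Tm b Γ τ
plug (appL N) M = app M N
plug (appR V _) M = app V M
plug (boxH Ws _ Ms body) M = box (Ws ++A (M ∷ Ms)) body

wkF : ∀ {b Γ ρ σ τ} → Frame b Γ σ τ → Frame b (ρ ∷ Γ) σ τ
wkF (appL N) = appL (wk N)
wkF (appR V v) = appR (wk V) (renVal there v)
wkF (boxH Ws vs Ms body) = boxH (renArgs there Ws) (renAllVal there vs) (renArgs there Ms) body

NotAppR : ∀ {b Γ σ τ} → Frame b Γ σ τ → Set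
NotAppR (appL _) = ⊤
NotAppR (appR _ _) = ⊥
NotAppR (boxH _ _ _ _) = ⊤

data ECtx (b : Bool) (Γ : Ctx) : Ty → Ty → Set where
  hole : ∀ {σ} → ECtx b Γ σ σ
  _∘_  : ∀ {σ ρ τ} → Frame b Γ ρ τ → ECtx b Γ σ ρ → ECtx b Γ σ τ

plugE : ∀ {b Γ σ τ} → ECtx b Γ σ τ → Tm b Γ σ → Tm b Γ τ
plugE hole M = M
plugE (C ∘ E) M = plug C (plugE E M)

wkE : ∀ {b Γ ρ σ τ} → ECtx b Γ σ τ → ECtx b (ρ ∷ Γ) σ τ
wkE hole = hole
wkE (C ∘ E) = wkF C ∘ wkE E

module _ (R : ∀ {b Γ σ} → Tm b Γ σ → Tm b Γ σ → Set) where
  mutual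
    data Comp : ∀ {b Γ σ} → Tm b Γ σ → Tm b Γ σ → Set where
      step  : ∀ {b Γ σ} {M N : Tm b Γ σ} → R M N → Comp M N
      lamC  : ∀ {b Γ σ τ} {M N : Tm b (σ ∷ Γ) τ} → Comp M N → Comp (lam M) (lam N)
      appLC : ∀ {b Γ σ τ} {M M' : Tm b Γ (σ ⊃ τ)} {N : Tm b Γ σ} →
              Comp M M' → Comp (app M N) (app M' N)
      appRC : ∀ {b Γ σ τ} {M : Tm b Γ (σ ⊃ τ)} {N N' : Tm b Γ σ} →
              Comp N N' → Comp (app M N) (app M N')
      boxAC : ∀ {b Γ Δ τ} {as as' : Args b Γ Δ} {M : Tm b Δ τ} →
              CompArgs as as' → Comp (box as M) (box as' M)
      boxBC : ∀ {b Γ Δ τ} {as : Args b Γ Δ} {M M' : Tm b Δ τ} →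
              Comp M M' → Comp (box as M) (box as M')
      let1C : ∀ {Γ σ τ} {M M' : Tm true Γ σ} {N : Tm true (σ ∷ Γ) τ} →
              Comp M M' → Comp (lett M N) (lett M' N)
      let2C : ∀ {Γ σ τ} {M : Tm true Γ σ} {N N' : Tm true (σ ∷ Γ) τ} →
              Comp N N' → Comp (lett M N) (lett M N')

    data CompArgs : ∀ {b Γ Δ} → Args b Γ Δ → Args b Γ Δ → Set where
      hd : ∀ {b Γ σ Δ} {a a' : Tm b Γ (□ σ)} {as : Args b Γ Δ} →
           Comp a a' → CompArgs (a ∷ as) (a' ∷ as)
      tl : ∀ {b Γ σ Δ} {a : Tm b Γ (□ σ)} {as as' : Args b Γ Δ} →
           CompArgs as as' → CompArgs (a ∷ as) (a ∷ as')

data BoxRule : ∀ {b Γ σ} → Tm b Γ σ → Tm b Γ σ → Set where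
  box-id : ∀ {b Γ σ} {M : Tm b Γ (□ σ)} → BoxRule (box (M ∷ []) (var here)) M
  box-merge : ∀ {b Γ Δw Δy Δz τ ρ}
              {Ws : Args b Γ Δw} {Ns : Args b Γ Δy} {V : Tm b Δy τ}
              {Ps : Args b Γ Δz} {M : Tm b (Δw ++ τ ∷ Δz) ρ} →
              AllVal Ws → Val V →
              BoxRule (box (Ws ++A (box Ns V ∷ Ps)) M)
                      (box (Ws ++A (Ns ++A Ps)) (sub (subBox Δw V) M))

data BaseV : ∀ {b Γ σ} → Tm b Γ σ → Tm b Γ σ → Set where
  v-id   : ∀ {b Γ σ} {M : Tm b Γ σ} → BaseV (app (lam (var here)) M) M
  v-beta : ∀ {b Γ σ τ} {M : Tm b (σ ∷ Γ) τ} {V : Tm b Γ σ} →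
           Val V → BaseV (app (lam M) V) (M [ V ])
  v-eta  : ∀ {b Γ σ τ} {V : Tm b Γ (σ ⊃ τ)} →
           Val V → BaseV (lam (app (wk V) (var here))) V
  v-lift : ∀ {b Γ ρ σ τ} (C : Frame b Γ σ τ) {M : Tm b (ρ ∷ Γ) σ} {N : Tm b Γ ρ} →
           BaseV (plug C (app (lam M) N)) (app (lam (plug (wkF C) M)) N)
  v-name : ∀ {b Γ ρ σ τ} (C : Frame b Γ σ τ) {y : Γ ∋ (ρ ⊃ σ)} {M : Tm b Γ ρ} →
           NotAppR C →
           BaseV (plug C (app (var y) M))
                 (app (lam (plug (wkF C) (var here))) (app (var y) M))
  v-unname : ∀ {b Γ ρ σ τ} (E : ECtx b Γ σ τ) {y : Γ ∋ (ρ ⊃ σ)} {M : Tm b Γ ρ} →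
           BaseV (app (lam (plugE (wkE E) (app (var (there y)) (var here)))) M)
                 (plugE E (app (var y) M))
  v-box  : ∀ {b Γ σ} {M N : Tm b Γ σ} → BoxRule M N → BaseV M N

data BaseC : ∀ {b Γ σ} → Tm b Γ σ → Tm b Γ σ → Set where
  c-letid : ∀ {Γ σ} {M : Tm true Γ σ} → BaseC (lett M (var here)) M
  c-letv  : ∀ {Γ σ τ} {V : Tm true Γ σ} {M : Tm true (σ ∷ Γ) τ} →
            Val V → BaseC (lett V M) (M [ V ])
  c-beta  : ∀ {b Γ σ τ} {M : Tm b (σ ∷ Γ) τ} {V : Tm b Γ σ} →
            Val V → BaseC (app (lam M) V) (M [ V ])
  c-eta   : ∀ {b Γ σ τ} {V : Tm b Γ (σ ⊃ τ)} →
            Val V → BaseC (lam (app (wk V) (var here))) V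
  c-assoc : ∀ {Γ ρ σ τ} {L : Tm true Γ ρ} {N : Tm true (ρ ∷ Γ) σ} {M : Tm true (σ ∷ Γ) τ} →
            BaseC (lett (lett L N) M) (lett L (lett N (ren (ext there) M)))
  c-let   : ∀ {Γ σ τ} (C : Frame true Γ σ τ) {A : Tm true Γ σ} →
            ¬ Val A → BaseC (plug C A) (lett A (plug (wkF C) (var here)))
  c-box   : ∀ {b Γ σ} {M N : Tm b Γ σ} → BoxRule M N → BaseC M N

infix 4 _→v_ _→c_ _=v_ _=c_

_→v_ : ∀ {Γ σ} → Tm false Γ σ → Tm false Γ σ → Set
M →v N = Comp BaseV M N

_→c_ : ∀ {Γ σ} → Tm true Γ σ → Tm true Γ σ → Set
M →c N = Comp BaseC M N

_=v_ : ∀ {Γ σ} → Tm false Γ σ → Tm false Γ σ → Set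
_=v_ {Γ} {σ} = EqClosure (_→v_ {Γ} {σ})

_=c_ : ∀ {Γ σ} → Tm true Γ σ → Tm true Γ σ → Set
_=c_ {Γ} {σ} = EqClosure (_→c_ {Γ} {σ})

-- Forward: (λx.M) N =c let x = N in M (by β when N is a value, by naming N otherwise), and
-- under this identification every rule of →v is an instance of the let rules of →c.
-- Backward: unlet, replacing let x = N in M by (λx.M) N, is a left inverse of emb and sends
-- every →c step into =v. The only nontrivial case is the naming rule, which becomes
-- C[A] =v (λx.C[x]) A. For C = V[ ] this is η and for a value A it is β. Otherwise, by
-- induction on the number of application and box nodes of A, A is first converted into a
-- redex (λx.B) N: (λz.z Q) M for A = M Q, and (λx.box(.., x, ..)) A' for a box whose first
-- non-value argument is A'. Lifting this redex out of C leaves B to be named inside C.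

{-# OPTIONS --safe #-}
module Submission where

open import Defs
open import Data.Bool using (Bool; true; false)
open import Data.Nat using (ℕ; suc; _+_; _<_; z≤n; s≤s)
open import Data.Nat.Properties using (+-assoc; m≤m+n; m≤n+m; +-monoʳ-<; +-monoˡ-<; module ≤-Reasoning)
open import Data.Nat.Induction using (<-wellFounded)
open import Data.List using ([]; _∷_; _++_)
open import Data.Unit using (tt)
open import Function.Base using (id; _∘′_)
open import Function.Bundles using (_⇔_; mk⇔)
open import Induction.WellFounded using (Acc; acc)
open import Relation.Nullary using (Dec; yes; no; ¬_; contradiction)
open import Relation.Binary.PropositionalEquality
  using (_≡_; refl; sym; trans; cong; cong₂; subst₂; module ≡-Reasoning)
open import Relation.Binary.Construct.Closure.Equivalence
  using (EqClosure; setoid; isEquivalence; symmetric; return; gmap; gfold)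
open import Relation.Binary.Construct.Closure.ReflexiveTransitive using (_◅◅_)
import Relation.Binary.Reasoning.Setoid as SetoidReasoning

private variable
  b : Bool
  Γ Δ Θ Ξ : Ctx
  σ τ ω υ : Ty

infix 4 _≗ˢ_
_≗ˢ_ : Sub b Γ Δ → Sub b Γ Δ → Set
s ≗ˢ s' = ∀ {σ} (x : _ ∋ σ) → s x ≡ s' x

exts-cong : {s s' : Sub b Γ Δ} → s ≗ˢ s' → exts {τ = τ} s ≗ˢ exts s'
exts-cong e here = refl
exts-cong e (there x) = cong wk (e x)

mutual
  sub-cong : {s s' : Sub b Γ Δ} → s ≗ˢ s' → (M : Tm b Γ σ) → sub s M ≡ sub s' M
  sub-cong e (con c) = refl
  sub-cong e (var x) = e x
  sub-cong e (lam M) = cong lam (sub-cong (exts-cong e) M)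
  sub-cong e (app M N) = cong₂ app (sub-cong e M) (sub-cong e N)
  sub-cong e (box as M) = cong (λ as → box as M) (subArgs-cong e as)
  sub-cong e (lett M N) = cong₂ lett (sub-cong e M) (sub-cong (exts-cong e) N)

  subArgs-cong : {s s' : Sub b Γ Δ} → s ≗ˢ s' → (as : Args b Γ Θ) → subArgs s as ≡ subArgs s' as
  subArgs-cong e [] = refl
  subArgs-cong e (a ∷ as) = cong₂ _∷_ (sub-cong e a) (subArgs-cong e as)

mutual
  sub-ren : (s : Sub b Δ Θ) (ρ : Ren Γ Δ) (M : Tm b Γ σ) → sub s (ren ρ M) ≡ sub (s ∘′ ρ) M
  sub-ren s ρ (con c) = refl
  sub-ren s ρ (var x) = refl
  sub-ren s ρ (lam M) =
    cong lam (trans (sub-ren (exts s) (ext ρ) M) (sub-cong (λ { here → refl ; (there x) → refl }) M))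
  sub-ren s ρ (app M N) = cong₂ app (sub-ren s ρ M) (sub-ren s ρ N)
  sub-ren s ρ (box as M) = cong (λ as → box as M) (subArgs-renArgs s ρ as)
  sub-ren s ρ (lett M N) =
    cong₂ lett (sub-ren s ρ M)
      (trans (sub-ren (exts s) (ext ρ) N) (sub-cong (λ { here → refl ; (there x) → refl }) N))

  subArgs-renArgs : (s : Sub b Δ Θ) (ρ : Ren Γ Δ) (as : Args b Γ Ξ) →
                    subArgs s (renArgs ρ as) ≡ subArgs (s ∘′ ρ) as
  subArgs-renArgs s ρ [] = refl
  subArgs-renArgs s ρ (a ∷ as) = cong₂ _∷_ (sub-ren s ρ a) (subArgs-renArgs s ρ as)

mutual
  sub-var : (ρ : Ren Γ Δ) (M : Tm b Γ σ) → sub (var ∘′ ρ) M ≡ ren ρ M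
  sub-var ρ (con c) = refl
  sub-var ρ (var x) = refl
  sub-var ρ (lam M) =
    cong lam (trans (sub-cong (λ { here → refl ; (there x) → refl }) M) (sub-var (ext ρ) M))
  sub-var ρ (app M N) = cong₂ app (sub-var ρ M) (sub-var ρ N)
  sub-var ρ (box as M) = cong (λ as → box as M) (subArgs-var ρ as)
  sub-var ρ (lett M N) =
    cong₂ lett (sub-var ρ M)
      (trans (sub-cong (λ { here → refl ; (there x) → refl }) N) (sub-var (ext ρ) N))

  subArgs-var : (ρ : Ren Γ Δ) (as : Args b Γ Ξ) → subArgs (var ∘′ ρ) as ≡ renArgs ρ as
  subArgs-var ρ [] = refl
  subArgs-var ρ (a ∷ as) = cong₂ _∷_ (sub-var ρ a) (subArgs-var ρ as)

mutual
  sub-id : (M : Tm b Γ σ) → sub var M ≡ M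
  sub-id (con c) = refl
  sub-id (var x) = refl
  sub-id (lam M) = cong lam (trans (sub-cong (λ { here → refl ; (there x) → refl }) M) (sub-id M))
  sub-id (app M N) = cong₂ app (sub-id M) (sub-id N)
  sub-id (box as M) = cong (λ as → box as M) (subArgs-id as)
  sub-id (lett M N) =
    cong₂ lett (sub-id M) (trans (sub-cong (λ { here → refl ; (there x) → refl }) N) (sub-id N))

  subArgs-id : (as : Args b Γ Ξ) → subArgs var as ≡ as
  subArgs-id [] = refl
  subArgs-id (a ∷ as) = cong₂ _∷_ (sub-id a) (subArgs-id as)

ren-id : (M : Tm b Γ σ) → ren id M ≡ M
ren-id M = trans (sym (sub-var id M)) (sub-id M)

renArgs-id : (as : Args b Γ Ξ) → renArgs id as ≡ as
renArgs-id as = trans (sym (subArgs-var id as)) (subArgs-id as)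

module _ (s : Sub b Δ Θ) (ρ : Ren Γ Δ) (ρ' : Ren Γ Θ) (e : s ∘′ ρ ≗ˢ var ∘′ ρ') where

  sub-ren-var : (M : Tm b Γ σ) → sub s (ren ρ M) ≡ ren ρ' M
  sub-ren-var M = trans (sub-ren s ρ M) (trans (sub-cong e M) (sub-var ρ' M))

  subArgs-renArgs-var : (as : Args b Γ Ξ) → subArgs s (renArgs ρ as) ≡ renArgs ρ' as
  subArgs-renArgs-var as = trans (subArgs-renArgs s ρ as) (trans (subArgs-cong e as) (subArgs-var ρ' as))

ren-∘ : (ρ : Ren Δ Θ) (ρ' : Ren Γ Δ) (M : Tm b Γ σ) → ren ρ (ren ρ' M) ≡ ren (ρ ∘′ ρ') M
ren-∘ ρ ρ' M =
  trans (sym (sub-var ρ (ren ρ' M))) (sub-ren-var (var ∘′ ρ) ρ' (ρ ∘′ ρ') (λ _ → refl) M)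

renArgs-∘ : (ρ : Ren Δ Θ) (ρ' : Ren Γ Δ) (as : Args b Γ Ξ) →
            renArgs ρ (renArgs ρ' as) ≡ renArgs (ρ ∘′ ρ') as
renArgs-∘ ρ ρ' as =
  trans (sym (subArgs-var ρ (renArgs ρ' as)))
        (subArgs-renArgs-var (var ∘′ ρ) ρ' (ρ ∘′ ρ') (λ _ → refl) as)

sub-ren-id : (s : Sub b Δ Γ) (ρ : Ren Γ Δ) → s ∘′ ρ ≗ˢ var →
             (M : Tm b Γ σ) → sub s (ren ρ M) ≡ M
sub-ren-id s ρ e M = trans (sub-ren-var s ρ id e M) (ren-id M)

subArgs-++A : (s : Sub b Γ Δ) (as : Args b Γ Θ) (bs : Args b Γ Ξ) →
              subArgs s (as ++A bs) ≡ subArgs s as ++A subArgs s bs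
subArgs-++A s [] bs = refl
subArgs-++A s (a ∷ as) bs = cong (sub s a ∷_) (subArgs-++A s as bs)

module RenamingNatural {b b'} (f : ∀ {Γ σ} → Tm b Γ σ → Tm b' Γ σ)
  (f-var : ∀ {Γ σ} (x : Γ ∋ σ) → f (var x) ≡ var x)
  (f-ren : ∀ {Γ Δ σ} (ρ : Ren Γ Δ) (M : Tm b Γ σ) → f (ren ρ M) ≡ ren ρ (f M)) where

  exts-natural : (s : Sub b Γ Δ) → f ∘′ exts {τ = τ} s ≗ˢ exts (f ∘′ s)
  exts-natural s here = f-var here
  exts-natural s (there x) = f-ren there (s x)

  sub0-natural : (V : Tm b Γ σ) → f ∘′ sub0 V ≗ˢ sub0 (f V)
  sub0-natural V here = refl
  sub0-natural V (there x) = f-var x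

  subBox-natural : ∀ Δw {Δy Δz} (V : Tm b Δy τ) →
                   f ∘′ subBox Δw {Δz = Δz} V ≗ˢ subBox Δw (f V)
  subBox-natural [] V here = f-ren inl V
  subBox-natural [] {Δy} V (there x) = f-var (inr Δy x)
  subBox-natural (_ ∷ Δw) V here = f-var here
  subBox-natural (_ ∷ Δw) V (there x) =
    trans (f-ren there (subBox Δw V x)) (cong wk (subBox-natural Δw V x))

mutual
  val? : (M : Tm b Γ σ) → Dec (Val M)
  val? (con c) = yes vcon
  val? (var x) = yes vvar
  val? (lam M) = yes vlam
  val? (app M N) = no λ ()
  val? (box as M) with allVal? as
  ... | yes vs = yes (vbox vs)
  ... | no ¬vs = no λ { (vbox vs) → ¬vs vs }
  val? (lett M N) = no λ ()

  allVal? : (as : Args b Γ Ξ) → Dec (AllVal as)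
  allVal? [] = yes []
  allVal? (a ∷ as) with val? a | allVal? as
  ... | yes v | yes vs = yes (v ∷ vs)
  ... | no ¬v | _ = no λ { (v ∷ _) → ¬v v }
  ... | yes _ | no ¬vs = no λ { (_ ∷ vs) → ¬vs vs }

data SplitAtNonValue {b Γ} : Args b Γ Δ → Set where
  split : ∀ {Δw Δz σ} (Vs : Args b Γ Δw) → AllVal Vs → (A : Tm b Γ (□ σ)) → ¬ Val A →
          (Ms : Args b Γ Δz) → SplitAtNonValue (Vs ++A (A ∷ Ms))

splitAtNonValue : (as : Args b Γ Ξ) → ¬ AllVal as → SplitAtNonValue as
splitAtNonValue [] ¬vs = contradiction [] ¬vs
splitAtNonValue (a ∷ as) ¬vs with val? a
... | no ¬v = split [] [] a ¬v as
... | yes v with splitAtNonValue as (λ vs → ¬vs (v ∷ vs))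
...   | split Vs vs A ¬vA Ms = split (a ∷ Vs) (v ∷ vs) A ¬vA Ms

renF : Ren Γ Δ → Frame b Γ σ τ → Frame b Δ σ τ
renF ρ (appL N) = appL (ren ρ N)
renF ρ (appR V v) = appR (ren ρ V) (renVal ρ v)
renF ρ (boxH Ws vs Ms M) = boxH (renArgs ρ Ws) (renAllVal ρ vs) (renArgs ρ Ms) M

wkF≡renF : (F : Frame b Γ σ τ) → wkF {ρ = ω} F ≡ renF there F
wkF≡renF (appL N) = refl
wkF≡renF (appR V v) = refl
wkF≡renF (boxH Ws vs Ms M) = refl

-- Frames carry proofs of valuehood, so equations between renamed frames are stated after
-- plugging.
plug-renF-id : (F : Frame b Γ σ τ) (N : Tm b Γ σ) → plug (renF id F) N ≡ plug F N
plug-renF-id (appL M) N = cong (app N) (ren-id M)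
plug-renF-id (appR V v) N = cong (λ V → app V N) (ren-id V)
plug-renF-id (boxH Ws vs Ms M) N =
  cong (λ as → box as M) (cong₂ _++A_ (renArgs-id Ws) (cong (N ∷_) (renArgs-id Ms)))

plug-renF-∘ : (ρ : Ren Δ Θ) (ρ' : Ren Γ Δ) (F : Frame b Γ σ τ) (N : Tm b Θ σ) →
              plug (renF ρ (renF ρ' F)) N ≡ plug (renF (ρ ∘′ ρ') F) N
plug-renF-∘ ρ ρ' (appL M) N = cong (app N) (ren-∘ ρ ρ' M)
plug-renF-∘ ρ ρ' (appR V v) N = cong (λ V → app V N) (ren-∘ ρ ρ' V)
plug-renF-∘ ρ ρ' (boxH Ws vs Ms M) N =
  cong (λ as → box as M) (cong₂ _++A_ (renArgs-∘ ρ ρ' Ws) (cong (N ∷_) (renArgs-∘ ρ ρ' Ms)))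

sub-plug-renF : (s : Sub b Θ Δ) (ρ : Ren Γ Θ) (ρ' : Ren Γ Δ) → s ∘′ ρ ≗ˢ var ∘′ ρ' →
                (F : Frame b Γ σ τ) (N : Tm b Θ σ) →
                sub s (plug (renF ρ F) N) ≡ plug (renF ρ' F) (sub s N)
sub-plug-renF s ρ ρ' e (appL M) N = cong (app (sub s N)) (sub-ren-var s ρ ρ' e M)
sub-plug-renF s ρ ρ' e (appR V v) N = cong (λ V → app V (sub s N)) (sub-ren-var s ρ ρ' e V)
sub-plug-renF s ρ ρ' e (boxH Ws vs Ms M) N =
  cong (λ as → box as M)
    (trans (subArgs-++A s (renArgs ρ Ws) _)
      (cong₂ _++A_ (subArgs-renArgs-var s ρ ρ' e Ws)
                   (cong (sub s N ∷_) (subArgs-renArgs-var s ρ ρ' e Ms))))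

ren-plug-renF : (ρ : Ren Θ Δ) (ρ' : Ren Γ Θ) (F : Frame b Γ σ τ) (N : Tm b Θ σ) →
                ren ρ (plug (renF ρ' F) N) ≡ plug (renF (ρ ∘′ ρ') F) (ren ρ N)
ren-plug-renF ρ ρ' F N = begin
  ren ρ (plug (renF ρ' F) N)
    ≡⟨ sub-var ρ _ ⟨
  sub (var ∘′ ρ) (plug (renF ρ' F) N)
    ≡⟨ sub-plug-renF (var ∘′ ρ) ρ' (ρ ∘′ ρ') (λ _ → refl) F N ⟩
  plug (renF (ρ ∘′ ρ') F) (sub (var ∘′ ρ) N)
    ≡⟨ cong (plug _) (sub-var ρ N) ⟩
  plug (renF (ρ ∘′ ρ') F) (ren ρ N)
    ∎
  where open ≡-Reasoning

plug-wkF-wkF : (F : Frame b Γ σ τ) (N : Tm b (υ ∷ ω ∷ Γ) σ) →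
               plug (wkF (wkF F)) N ≡ plug (renF (there ∘′ there) F) N
plug-wkF-wkF F N =
  trans (cong (λ G → plug G N) (trans (wkF≡renF (wkF F)) (cong (renF there) (wkF≡renF F))))
        (plug-renF-∘ there there F N)

plug-wkF-[] : (F : Frame b Γ σ τ) (N : Tm b (ω ∷ Γ) σ) (W : Tm b Γ ω) →
              plug (wkF F) N [ W ] ≡ plug F (N [ W ])
plug-wkF-[] F N W = begin
  plug (wkF F) N [ W ]         ≡⟨ cong (λ G → plug G N [ W ]) (wkF≡renF F) ⟩
  plug (renF there F) N [ W ]  ≡⟨ sub-plug-renF (sub0 W) there id (λ _ → refl) F N ⟩
  plug (renF id F) (N [ W ])   ≡⟨ plug-renF-id F _ ⟩
  plug F (N [ W ])             ∎
  where open ≡-Reasoning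

ren-ext-plug-wkF : (F : Frame b Γ σ τ) (N : Tm b (ω ∷ Γ) σ) →
                   ren (ext (there {τ = υ})) (plug (wkF F) N) ≡ plug (wkF (wkF F)) (ren (ext there) N)
ren-ext-plug-wkF F N = begin
  ren (ext there) (plug (wkF F) N)
    ≡⟨ cong (λ G → ren (ext there) (plug G N)) (wkF≡renF F) ⟩
  ren (ext there) (plug (renF there F) N)
    ≡⟨ ren-plug-renF (ext there) there F N ⟩
  plug (renF (there ∘′ there) F) (ren (ext there) N)
    ≡⟨ plug-wkF-wkF F _ ⟨
  plug (wkF (wkF F)) (ren (ext there) N)
    ∎
  where open ≡-Reasoning

wkF-NotAppR : (F : Frame b Γ σ τ) → NotAppR F → NotAppR (wkF {ρ = ω} F)
wkF-NotAppR (appL _) _ = tt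
wkF-NotAppR (boxH _ _ _ _) _ = tt

module _ {R : ∀ {b Γ σ} → Tm b Γ σ → Tm b Γ σ → Set} where

  CompArgs-at : ∀ {Δw Δz} (Ws : Args b Γ Δw) {M N : Tm b Γ (□ σ)} (Ms : Args b Γ Δz) →
                Comp R M N → CompArgs R (Ws ++A (M ∷ Ms)) (Ws ++A (N ∷ Ms))
  CompArgs-at [] Ms p = hd p
  CompArgs-at (W ∷ Ws) Ms p = tl (CompArgs-at Ws Ms p)

  plug-Comp : (F : Frame b Γ σ τ) {M N : Tm b Γ σ} → Comp R M N → Comp R (plug F M) (plug F N)
  plug-Comp (appL N) p = appLC p
  plug-Comp (appR V v) p = appRC p
  plug-Comp (boxH Ws vs Ms M) p = boxAC (CompArgs-at Ws Ms p)

module =v-Reasoning {Γ σ} = SetoidReasoning (setoid (_→v_ {Γ} {σ}))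
module =c-Reasoning {Γ σ} = SetoidReasoning (setoid (_→c_ {Γ} {σ}))

v-rule : {M N : Tm false Γ σ} → BaseV M N → M =v N
v-rule r = return (step r)

c-rule : {M N : Tm true Γ σ} → BaseC M N → M =c N
c-rule r = return (step r)

-- Let-conversions in the computational calculus

app-lam=let : (M : Tm true (σ ∷ Γ) τ) (N : Tm true Γ σ) → app (lam M) N =c lett N M
app-lam=let M N with val? N
... | yes v = c-rule (c-beta v) ◅◅ symmetric _ (c-rule (c-letv v))
... | no ¬v = begin
  app (lam M) N
    ≈⟨ c-rule (c-let (appR (lam M) vlam) ¬v) ⟩
  lett N (app (lam (ren (ext there) M)) (var here))
    ≈⟨ return (let2C (step (c-beta vvar))) ⟩
  lett N (ren (ext there) M [ var here ])
    ≡⟨ cong (lett N) (sub-ren-id _ _ (λ { here → refl ; (there x) → refl }) M) ⟩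
  lett N M
    ∎
  where open =c-Reasoning

let-var=plug : (F : Frame true Γ σ τ) (M : Tm true Γ σ) → lett M (plug (wkF F) (var here)) =c plug F M
let-var=plug F M with val? M
... | yes v = begin
  lett M (plug (wkF F) (var here))  ≈⟨ c-rule (c-letv v) ⟩
  plug (wkF F) (var here) [ M ]     ≡⟨ plug-wkF-[] F (var here) M ⟩
  plug F M                          ∎
  where open =c-Reasoning
... | no ¬v = symmetric _ (c-rule (c-let F ¬v))

plug-let : (C : Frame true Γ σ τ) (N : Tm true Γ ω) (M : Tm true (ω ∷ Γ) σ) →
           plug C (lett N M) =c lett N (plug (wkF C) M)
plug-let C N M = begin
  plug C (lett N M)
    ≈⟨ c-rule (c-let C λ ()) ⟩
  lett (lett N M) (plug (wkF C) (var here))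
    ≈⟨ c-rule c-assoc ⟩
  lett N (lett M (ren (ext there) (plug (wkF C) (var here))))
    ≡⟨ cong (lett N ∘′ lett M) (ren-ext-plug-wkF C (var here)) ⟩
  lett N (lett M (plug (wkF (wkF C)) (var here)))
    ≈⟨ gmap (lett N) let2C (let-var=plug (wkF C) M) ⟩
  lett N (plug (wkF C) M)
    ∎
  where open =c-Reasoning

plugE-app=let : (E : ECtx true Γ σ τ) (y : Γ ∋ ω ⊃ σ) (M : Tm true Γ ω) →
                plugE E (app (var y) M) =c lett M (plugE (wkE E) (app (var (there y)) (var here)))
plugE-app=let hole y M with val? M
... | yes v = symmetric _ (c-rule (c-letv v))
... | no ¬v = c-rule (c-let (appR (var y) vvar) ¬v)
plugE-app=let (C ∘ E) y M = gmap (plug C) (plug-Comp C) (plugE-app=let E y M) ◅◅ plug-let C M _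

-- The embedding of the restricted calculus

mutual
  emb-ren : (ρ : Ren Γ Δ) (M : Tm false Γ σ) → emb (ren ρ M) ≡ ren ρ (emb M)
  emb-ren ρ (con c) = refl
  emb-ren ρ (var x) = refl
  emb-ren ρ (lam M) = cong lam (emb-ren (ext ρ) M)
  emb-ren ρ (app M N) = cong₂ app (emb-ren ρ M) (emb-ren ρ N)
  emb-ren ρ (box as M) = cong (λ as → box as (emb M)) (embArgs-ren ρ as)

  embArgs-ren : (ρ : Ren Γ Δ) (as : Args false Γ Ξ) → embArgs (renArgs ρ as) ≡ renArgs ρ (embArgs as)
  embArgs-ren ρ [] = refl
  embArgs-ren ρ (a ∷ as) = cong₂ _∷_ (emb-ren ρ a) (embArgs-ren ρ as)

module Emb = RenamingNatural emb (λ _ → refl) emb-ren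

mutual
  emb-sub : (s : Sub false Γ Δ) (M : Tm false Γ σ) → emb (sub s M) ≡ sub (emb ∘′ s) (emb M)
  emb-sub s (con c) = refl
  emb-sub s (var x) = refl
  emb-sub s (lam M) = cong lam (trans (emb-sub (exts s) M) (sub-cong (Emb.exts-natural s) (emb M)))
  emb-sub s (app M N) = cong₂ app (emb-sub s M) (emb-sub s N)
  emb-sub s (box as M) = cong (λ as → box as (emb M)) (embArgs-sub s as)

  embArgs-sub : (s : Sub false Γ Δ) (as : Args false Γ Ξ) →
                embArgs (subArgs s as) ≡ subArgs (emb ∘′ s) (embArgs as)
  embArgs-sub s [] = refl
  embArgs-sub s (a ∷ as) = cong₂ _∷_ (emb-sub s a) (embArgs-sub s as)

emb-[] : (M : Tm false (σ ∷ Γ) τ) (V : Tm false Γ σ) → emb (M [ V ]) ≡ emb M [ emb V ]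
emb-[] M V = trans (emb-sub (sub0 V) M) (sub-cong (Emb.sub0-natural V) (emb M))

embArgs-++A : (as : Args false Γ Θ) (bs : Args false Γ Ξ) →
              embArgs (as ++A bs) ≡ embArgs as ++A embArgs bs
embArgs-++A [] bs = refl
embArgs-++A (a ∷ as) bs = cong (emb a ∷_) (embArgs-++A as bs)

mutual
  emb-Val : {V : Tm false Γ σ} → Val V → Val (emb V)
  emb-Val vcon = vcon
  emb-Val vvar = vvar
  emb-Val vlam = vlam
  emb-Val (vbox vs) = vbox (emb-AllVal vs)

  emb-AllVal : {as : Args false Γ Ξ} → AllVal as → AllVal (embArgs as)
  emb-AllVal [] = []
  emb-AllVal (v ∷ vs) = emb-Val v ∷ emb-AllVal vs

embF : Frame false Γ σ τ → Frame true Γ σ τ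
embF (appL N) = appL (emb N)
embF (appR V v) = appR (emb V) (emb-Val v)
embF (boxH Ws vs Ms M) = boxH (embArgs Ws) (emb-AllVal vs) (embArgs Ms) (emb M)

embE : ECtx false Γ σ τ → ECtx true Γ σ τ
embE hole = hole
embE (C ∘ E) = embF C ∘ embE E

emb-plug : (F : Frame false Γ σ τ) (M : Tm false Γ σ) → emb (plug F M) ≡ plug (embF F) (emb M)
emb-plug (appL N) M = refl
emb-plug (appR V v) M = refl
emb-plug (boxH Ws vs Ms B) M = cong (λ as → box as (emb B)) (embArgs-++A Ws (M ∷ Ms))

emb-plug-wkF : (F : Frame false Γ σ τ) (M : Tm false (ω ∷ Γ) σ) →
               emb (plug (wkF F) M) ≡ plug (wkF (embF F)) (emb M)
emb-plug-wkF (appL N) M = cong (app (emb M)) (emb-ren there N)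
emb-plug-wkF (appR V v) M = cong (λ V → app V (emb M)) (emb-ren there V)
emb-plug-wkF (boxH Ws vs Ms B) M =
  cong (λ as → box as (emb B))
    (trans (embArgs-++A (renArgs there Ws) _)
      (cong₂ _++A_ (embArgs-ren there Ws) (cong (emb M ∷_) (embArgs-ren there Ms))))

emb-plugE : (E : ECtx false Γ σ τ) (M : Tm false Γ σ) → emb (plugE E M) ≡ plugE (embE E) (emb M)
emb-plugE hole M = refl
emb-plugE (C ∘ E) M = trans (emb-plug C (plugE E M)) (cong (plug (embF C)) (emb-plugE E M))

emb-plugE-wkE : (E : ECtx false Γ σ τ) (M : Tm false (ω ∷ Γ) σ) →
                emb (plugE (wkE E) M) ≡ plugE (wkE (embE E)) (emb M)
emb-plugE-wkE hole M = refl
emb-plugE-wkE (C ∘ E) M =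
  trans (emb-plug-wkF C (plugE (wkE E) M)) (cong (plug (wkF (embF C))) (emb-plugE-wkE E M))

emb-BoxRule : {P Q : Tm false Γ σ} → BoxRule P Q → BoxRule (emb P) (emb Q)
emb-BoxRule box-id = box-id
emb-BoxRule (box-merge {Δw = Δw} {Ws = Ws} {Ns} {V} {Ps} {M} vs v) =
  subst₂ BoxRule
    (cong (λ as → box as (emb M)) (sym (embArgs-++A Ws _)))
    (sym (cong₂ box (trans (embArgs-++A Ws _) (cong (embArgs Ws ++A_) (embArgs-++A Ns Ps)))
                    (trans (emb-sub (subBox Δw V) M) (sub-cong (Emb.subBox-natural Δw V) (emb M)))))
    (box-merge (emb-AllVal vs) (emb-Val v))

emb-BaseV : {P Q : Tm false Γ σ} → BaseV P Q → emb P =c emb Q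
emb-BaseV (v-id {M = M}) = app-lam=let (var here) (emb M) ◅◅ c-rule c-letid
emb-BaseV (v-beta {M = M} {V = V} v) = begin
  app (lam (emb M)) (emb V)  ≈⟨ c-rule (c-beta (emb-Val v)) ⟩
  emb M [ emb V ]            ≡⟨ emb-[] M V ⟨
  emb (M [ V ])              ∎
  where open =c-Reasoning
emb-BaseV (v-eta {V = V} v) = begin
  lam (app (emb (wk V)) (var here))  ≡⟨ cong (λ V → lam (app V (var here))) (emb-ren there V) ⟩
  lam (app (wk (emb V)) (var here))  ≈⟨ c-rule (c-eta (emb-Val v)) ⟩
  emb V                              ∎
  where open =c-Reasoning
emb-BaseV (v-lift C {M = M} {N = N}) = begin
  emb (plug C (app (lam M) N))
    ≡⟨ emb-plug C _ ⟩
  plug (embF C) (app (lam (emb M)) (emb N))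
    ≈⟨ gmap (plug (embF C)) (plug-Comp (embF C)) (app-lam=let (emb M) (emb N)) ⟩
  plug (embF C) (lett (emb N) (emb M))
    ≈⟨ plug-let (embF C) (emb N) (emb M) ⟩
  lett (emb N) (plug (wkF (embF C)) (emb M))
    ≈⟨ app-lam=let _ (emb N) ⟨
  app (lam (plug (wkF (embF C)) (emb M))) (emb N)
    ≡⟨ cong (λ K → app (lam K) (emb N)) (emb-plug-wkF C M) ⟨
  emb (app (lam (plug (wkF C) M)) N)
    ∎
  where open =c-Reasoning
emb-BaseV (v-name C {y = y} {M = M} _) = begin
  emb (plug C (app (var y) M))
    ≡⟨ emb-plug C _ ⟩
  plug (embF C) (app (var y) (emb M))
    ≈⟨ let-var=plug (embF C) _ ⟨
  lett (app (var y) (emb M)) (plug (wkF (embF C)) (var here))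
    ≈⟨ app-lam=let _ _ ⟨
  app (lam (plug (wkF (embF C)) (var here))) (app (var y) (emb M))
    ≡⟨ cong (λ K → app (lam K) _) (emb-plug-wkF C (var here)) ⟨
  emb (app (lam (plug (wkF C) (var here))) (app (var y) M))
    ∎
  where open =c-Reasoning
emb-BaseV (v-unname E {y = y} {M = M}) = begin
  emb (app (lam (plugE (wkE E) (app (var (there y)) (var here)))) M)
    ≡⟨ cong (λ K → app (lam K) (emb M)) (emb-plugE-wkE E _) ⟩
  app (lam (plugE (wkE (embE E)) (app (var (there y)) (var here)))) (emb M)
    ≈⟨ app-lam=let _ (emb M) ⟩
  lett (emb M) (plugE (wkE (embE E)) (app (var (there y)) (var here)))
    ≈⟨ plugE-app=let (embE E) y (emb M) ⟨
  plugE (embE E) (app (var y) (emb M))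
    ≡⟨ emb-plugE E _ ⟨
  emb (plugE E (app (var y) M))
    ∎
  where open =c-Reasoning
emb-BaseV (v-box r) = c-rule (c-box (emb-BoxRule r))

mutual
  emb-→v : {P Q : Tm false Γ σ} → P →v Q → emb P =c emb Q
  emb-→v (step r) = emb-BaseV r
  emb-→v (lamC p) = gmap lam lamC (emb-→v p)
  emb-→v (appLC {N = N} p) = gmap (λ M → app M (emb N)) appLC (emb-→v p)
  emb-→v (appRC {M = M} p) = gmap (app (emb M)) appRC (emb-→v p)
  emb-→v (boxAC {M = M} p) = gmap (λ as → box as (emb M)) boxAC (embArgs-CompArgs p)
  emb-→v (boxBC {as = as} p) = gmap (box (embArgs as)) boxBC (emb-→v p)

  embArgs-CompArgs : {as as' : Args false Γ Ξ} → CompArgs BaseV as as' →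
                     EqClosure (CompArgs BaseC) (embArgs as) (embArgs as')
  embArgs-CompArgs (hd {as = as} p) = gmap (_∷ embArgs as) hd (emb-→v p)
  embArgs-CompArgs (tl {a = a} p) = gmap (emb a ∷_) tl (embArgs-CompArgs p)

-- Naming a subterm in the restricted calculus

-- Variables and box bodies weigh nothing, so replacing a non-value box argument by a
-- variable makes the box lighter.
mutual
  weight : Tm b Γ σ → ℕ
  weight (con c) = 0
  weight (var x) = 0
  weight (lam M) = weight M
  weight (app M N) = suc (weight M + weight N)
  weight (box as M) = suc (weightArgs as)
  weight (lett M N) = suc (weight M + weight N)

  weightArgs : Args b Γ Ξ → ℕ
  weightArgs [] = 0
  weightArgs (a ∷ as) = weight a + weightArgs as

mutual
  weight-ren : (ρ : Ren Γ Δ) (M : Tm b Γ σ) → weight (ren ρ M) ≡ weight M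
  weight-ren ρ (con c) = refl
  weight-ren ρ (var x) = refl
  weight-ren ρ (lam M) = weight-ren (ext ρ) M
  weight-ren ρ (app M N) = cong suc (cong₂ _+_ (weight-ren ρ M) (weight-ren ρ N))
  weight-ren ρ (box as M) = cong suc (weightArgs-ren ρ as)
  weight-ren ρ (lett M N) = cong suc (cong₂ _+_ (weight-ren ρ M) (weight-ren (ext ρ) N))

  weightArgs-ren : (ρ : Ren Γ Δ) (as : Args b Γ Ξ) → weightArgs (renArgs ρ as) ≡ weightArgs as
  weightArgs-ren ρ [] = refl
  weightArgs-ren ρ (a ∷ as) = cong₂ _+_ (weight-ren ρ a) (weightArgs-ren ρ as)

weightArgs-++A : (as : Args b Γ Θ) (bs : Args b Γ Ξ) →
                 weightArgs (as ++A bs) ≡ weightArgs as + weightArgs bs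
weightArgs-++A [] bs = refl
weightArgs-++A (a ∷ as) bs =
  trans (cong (weight a +_) (weightArgs-++A as bs)) (sym (+-assoc (weight a) _ _))

nonValue-weight : (A : Tm b Γ σ) → ¬ Val A → 0 < weight A
nonValue-weight (con c) ¬v = contradiction vcon ¬v
nonValue-weight (var x) ¬v = contradiction vvar ¬v
nonValue-weight (lam M) ¬v = contradiction vlam ¬v
nonValue-weight (app M N) _ = s≤s z≤n
nonValue-weight (box as M) _ = s≤s z≤n
nonValue-weight (lett M N) _ = s≤s z≤n

module _ {Δw Δz} (Vs : Args b Γ Δw) (A : Tm b Γ (□ σ)) (Ms : Args b Γ Δz)
         (B : Tm b (Δw ++ σ ∷ Δz) τ) where
  open ≤-Reasoning

  weight-box-arg : weight A < weight (box (Vs ++A (A ∷ Ms)) B)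
  weight-box-arg = s≤s (begin
    weight A                                     ≤⟨ m≤m+n _ _ ⟩
    weight A + weightArgs Ms                     ≤⟨ m≤n+m _ (weightArgs Vs) ⟩
    weightArgs Vs + (weight A + weightArgs Ms)   ≡⟨ weightArgs-++A Vs (A ∷ Ms) ⟨
    weightArgs (Vs ++A (A ∷ Ms))                 ∎)

  weight-box-var : 0 < weight A →
                   weight (box (renArgs there Vs ++A (var here ∷ renArgs there Ms)) B)
                     < weight (box (Vs ++A (A ∷ Ms)) B)
  weight-box-var 0<A = s≤s (begin-strict
    weightArgs (renArgs there Vs ++A (var here ∷ renArgs there Ms))
      ≡⟨ weightArgs-++A (renArgs there Vs) _ ⟩
    weightArgs (renArgs there Vs) + weightArgs (renArgs there Ms)
      ≡⟨ cong₂ _+_ (weightArgs-ren there Vs) (weightArgs-ren there Ms) ⟩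
    weightArgs Vs + weightArgs Ms
      <⟨ +-monoʳ-< (weightArgs Vs) (+-monoˡ-< (weightArgs Ms) 0<A) ⟩
    weightArgs Vs + (weight A + weightArgs Ms)
      ≡⟨ weightArgs-++A Vs (A ∷ Ms) ⟨
    weightArgs (Vs ++A (A ∷ Ms))
      ∎)

named : Frame b Γ σ τ → Tm b Γ σ → Tm b Γ τ
named C A = app (lam (plug (wkF C) (var here))) A

module _ (C : Frame false Γ σ τ) where
  open =v-Reasoning

  named-value : {W : Tm false Γ σ} → Val W → named C W =v plug C W
  named-value {W = W} w = begin
    named C W                      ≈⟨ v-rule (v-beta w) ⟩
    plug (wkF C) (var here) [ W ]  ≡⟨ plug-wkF-[] C (var here) W ⟩
    plug C W                       ∎

  named-redex : (B : Tm false (ω ∷ Γ) σ) (N : Tm false Γ ω) →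
                plug (wkF C) B =v named (wkF C) B → plug C (app (lam B) N) =v named C (app (lam B) N)
  named-redex B N CB=v = begin
    plug C (app (lam B) N)
      ≈⟨ v-rule (v-lift C) ⟩
    app (lam (plug (wkF C) B)) N
      ≈⟨ gmap (λ K → app (lam K) N) (appLC ∘′ lamC) CB=v ⟩
    app (lam (named (wkF C) B)) N
      ≡⟨ cong (λ K → app (lam (app (lam K) B)) N) (ren-ext-plug-wkF C (var here)) ⟨
    app (lam (app (lam (ren (ext there) (plug (wkF C) (var here)))) B)) N
      ≈⟨ v-rule (v-lift (appR (lam (plug (wkF C) (var here))) vlam)) ⟨
    named C (app (lam B) N)
      ∎

  named-via : {A : Tm false Γ σ} (B : Tm false (ω ∷ Γ) σ) (N : Tm false Γ ω) → A =v app (lam B) N →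
              plug (wkF C) B =v named (wkF C) B → plug C A =v named C A
  named-via {A = A} B N A=v CB=v = begin
    plug C A                 ≈⟨ gmap (plug C) (plug-Comp C) A=v ⟩
    plug C (app (lam B) N)   ≈⟨ named-redex B N CB=v ⟩
    named C (app (lam B) N)  ≈⟨ gmap (named C) appRC A=v ⟨
    named C A                ∎

named-notAppR : (C : Frame false Γ σ τ) → NotAppR C → (A : Tm false Γ σ) → Acc _<_ (weight A) →
                plug C A =v named C A
named-notAppR C ¬appR (con c) _ = symmetric _ (named-value C vcon)
named-notAppR C ¬appR (var x) _ = symmetric _ (named-value C vvar)
named-notAppR C ¬appR (lam M) _ = symmetric _ (named-value C vlam)
-- M Q =v (λz. z Q) M, and the variable-headed z Q is named by v-name.
named-notAppR C ¬appR (app M Q) (acc rs) =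
  named-via C (app (var here) (wk Q)) M
    (named-notAppR (appL Q) tt M (rs (s≤s (m≤m+n _ _))))
    (v-rule (v-name (wkF C) (wkF-NotAppR C ¬appR)))
named-notAppR C ¬appR (box as B) (acc rs) with allVal? as
... | yes vs = symmetric _ (named-value C (vbox vs))
... | no ¬vs with splitAtNonValue as ¬vs
...   | split Vs vs A ¬vA Ms =
  named-via C (plug (wkF (boxH Vs vs Ms B)) (var here)) A
    (named-notAppR (boxH Vs vs Ms B) tt A (rs (weight-box-arg Vs A Ms B)))
    (named-notAppR (wkF C) (wkF-NotAppR C ¬appR) (plug (wkF (boxH Vs vs Ms B)) (var here))
      (rs (weight-box-var Vs A Ms B (nonValue-weight A ¬vA))))

plug=named : (C : Frame false Γ σ τ) (A : Tm false Γ σ) → plug C A =v named C A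
plug=named (appR V v) A = symmetric _ (return (appLC (step (v-eta v))))
plug=named C@(appL _) A = named-notAppR C tt A (<-wellFounded _)
plug=named C@(boxH _ _ _ _) A = named-notAppR C tt A (<-wellFounded _)

-- Eliminating let

mutual
  unlet : Tm true Γ σ → Tm false Γ σ
  unlet (con c) = con c
  unlet (var x) = var x
  unlet (lam M) = lam (unlet M)
  unlet (app M N) = app (unlet M) (unlet N)
  unlet (box as M) = box (unletArgs as) (unlet M)
  unlet (lett M N) = app (lam (unlet N)) (unlet M)

  unletArgs : Args true Γ Ξ → Args false Γ Ξ
  unletArgs [] = []
  unletArgs (a ∷ as) = unlet a ∷ unletArgs as

mutual
  unlet-ren : (ρ : Ren Γ Δ) (M : Tm true Γ σ) → unlet (ren ρ M) ≡ ren ρ (unlet M)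
  unlet-ren ρ (con c) = refl
  unlet-ren ρ (var x) = refl
  unlet-ren ρ (lam M) = cong lam (unlet-ren (ext ρ) M)
  unlet-ren ρ (app M N) = cong₂ app (unlet-ren ρ M) (unlet-ren ρ N)
  unlet-ren ρ (box as M) = cong (λ as → box as (unlet M)) (unletArgs-ren ρ as)
  unlet-ren ρ (lett M N) = cong₂ (λ N M → app (lam N) M) (unlet-ren (ext ρ) N) (unlet-ren ρ M)

  unletArgs-ren : (ρ : Ren Γ Δ) (as : Args true Γ Ξ) →
                  unletArgs (renArgs ρ as) ≡ renArgs ρ (unletArgs as)
  unletArgs-ren ρ [] = refl
  unletArgs-ren ρ (a ∷ as) = cong₂ _∷_ (unlet-ren ρ a) (unletArgs-ren ρ as)

module Unlet = RenamingNatural unlet (λ _ → refl) unlet-ren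

mutual
  unlet-sub : (s : Sub true Γ Δ) (M : Tm true Γ σ) → unlet (sub s M) ≡ sub (unlet ∘′ s) (unlet M)
  unlet-sub s (con c) = refl
  unlet-sub s (var x) = refl
  unlet-sub s (lam M) =
    cong lam (trans (unlet-sub (exts s) M) (sub-cong (Unlet.exts-natural s) (unlet M)))
  unlet-sub s (app M N) = cong₂ app (unlet-sub s M) (unlet-sub s N)
  unlet-sub s (box as M) = cong (λ as → box as (unlet M)) (unletArgs-sub s as)
  unlet-sub s (lett M N) =
    cong₂ (λ N M → app (lam N) M)
      (trans (unlet-sub (exts s) N) (sub-cong (Unlet.exts-natural s) (unlet N))) (unlet-sub s M)

  unletArgs-sub : (s : Sub true Γ Δ) (as : Args true Γ Ξ) →
                  unletArgs (subArgs s as) ≡ subArgs (unlet ∘′ s) (unletArgs as)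
  unletArgs-sub s [] = refl
  unletArgs-sub s (a ∷ as) = cong₂ _∷_ (unlet-sub s a) (unletArgs-sub s as)

unlet-[] : (M : Tm true (σ ∷ Γ) τ) (V : Tm true Γ σ) → unlet (M [ V ]) ≡ unlet M [ unlet V ]
unlet-[] M V = trans (unlet-sub (sub0 V) M) (sub-cong (Unlet.sub0-natural V) (unlet M))

unletArgs-++A : (as : Args true Γ Θ) (bs : Args true Γ Ξ) →
                unletArgs (as ++A bs) ≡ unletArgs as ++A unletArgs bs
unletArgs-++A [] bs = refl
unletArgs-++A (a ∷ as) bs = cong (unlet a ∷_) (unletArgs-++A as bs)

mutual
  unlet-emb : (M : Tm false Γ σ) → unlet (emb M) ≡ M
  unlet-emb (con c) = refl
  unlet-emb (var x) = refl
  unlet-emb (lam M) = cong lam (unlet-emb M)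
  unlet-emb (app M N) = cong₂ app (unlet-emb M) (unlet-emb N)
  unlet-emb (box as M) = cong₂ box (unletArgs-embArgs as) (unlet-emb M)

  unletArgs-embArgs : (as : Args false Γ Ξ) → unletArgs (embArgs as) ≡ as
  unletArgs-embArgs [] = refl
  unletArgs-embArgs (a ∷ as) = cong₂ _∷_ (unlet-emb a) (unletArgs-embArgs as)

mutual
  unlet-Val : {V : Tm true Γ σ} → Val V → Val (unlet V)
  unlet-Val vcon = vcon
  unlet-Val vvar = vvar
  unlet-Val vlam = vlam
  unlet-Val (vbox vs) = vbox (unlet-AllVal vs)

  unlet-AllVal : {as : Args true Γ Ξ} → AllVal as → AllVal (unletArgs as)
  unlet-AllVal [] = []
  unlet-AllVal (v ∷ vs) = unlet-Val v ∷ unlet-AllVal vs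

unletF : Frame true Γ σ τ → Frame false Γ σ τ
unletF (appL N) = appL (unlet N)
unletF (appR V v) = appR (unlet V) (unlet-Val v)
unletF (boxH Ws vs Ms M) = boxH (unletArgs Ws) (unlet-AllVal vs) (unletArgs Ms) (unlet M)

unlet-plug : (F : Frame true Γ σ τ) (M : Tm true Γ σ) → unlet (plug F M) ≡ plug (unletF F) (unlet M)
unlet-plug (appL N) M = refl
unlet-plug (appR V v) M = refl
unlet-plug (boxH Ws vs Ms B) M = cong (λ as → box as (unlet B)) (unletArgs-++A Ws (M ∷ Ms))

unlet-plug-wkF : (F : Frame true Γ σ τ) (M : Tm true (ω ∷ Γ) σ) →
                 unlet (plug (wkF F) M) ≡ plug (wkF (unletF F)) (unlet M)
unlet-plug-wkF (appL N) M = cong (app (unlet M)) (unlet-ren there N)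
unlet-plug-wkF (appR V v) M = cong (λ V → app V (unlet M)) (unlet-ren there V)
unlet-plug-wkF (boxH Ws vs Ms B) M =
  cong (λ as → box as (unlet B))
    (trans (unletArgs-++A (renArgs there Ws) _)
      (cong₂ _++A_ (unletArgs-ren there Ws) (cong (unlet M ∷_) (unletArgs-ren there Ms))))

unlet-BoxRule : {P Q : Tm true Γ σ} → BoxRule P Q → BoxRule (unlet P) (unlet Q)
unlet-BoxRule box-id = box-id
unlet-BoxRule (box-merge {Δw = Δw} {Ws = Ws} {Ns} {V} {Ps} {M} vs v) =
  subst₂ BoxRule
    (cong (λ as → box as (unlet M)) (sym (unletArgs-++A Ws _)))
    (sym (cong₂ box (trans (unletArgs-++A Ws _) (cong (unletArgs Ws ++A_) (unletArgs-++A Ns Ps)))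
                    (trans (unlet-sub (subBox Δw V) M) (sub-cong (Unlet.subBox-natural Δw V) (unlet M)))))
    (box-merge (unlet-AllVal vs) (unlet-Val v))

unlet-BaseC : {P Q : Tm true Γ σ} → BaseC P Q → unlet P =v unlet Q
unlet-BaseC c-letid = v-rule v-id
unlet-BaseC (c-letv {V = V} {M = M} v) = begin
  app (lam (unlet M)) (unlet V)  ≈⟨ v-rule (v-beta (unlet-Val v)) ⟩
  unlet M [ unlet V ]            ≡⟨ unlet-[] M V ⟨
  unlet (M [ V ])                ∎
  where open =v-Reasoning
unlet-BaseC (c-beta {M = M} {V = V} v) = begin
  app (lam (unlet M)) (unlet V)  ≈⟨ v-rule (v-beta (unlet-Val v)) ⟩
  unlet M [ unlet V ]            ≡⟨ unlet-[] M V ⟨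
  unlet (M [ V ])                ∎
  where open =v-Reasoning
unlet-BaseC (c-eta {V = V} v) = begin
  lam (app (unlet (wk V)) (var here))  ≡⟨ cong (λ V → lam (app V (var here))) (unlet-ren there V) ⟩
  lam (app (wk (unlet V)) (var here))  ≈⟨ v-rule (v-eta (unlet-Val v)) ⟩
  unlet V                              ∎
  where open =v-Reasoning
unlet-BaseC (c-assoc {L = L} {N = N} {M = M}) = begin
  app (lam (unlet M)) (app (lam (unlet N)) (unlet L))
    ≈⟨ v-rule (v-lift (appR (lam (unlet M)) vlam)) ⟩
  app (lam (app (lam (ren (ext there) (unlet M))) (unlet N))) (unlet L)
    ≡⟨ cong (λ M → app (lam (app (lam M) (unlet N))) (unlet L)) (unlet-ren (ext there) M) ⟨
  app (lam (app (lam (unlet (ren (ext there) M))) (unlet N))) (unlet L)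
    ∎
  where open =v-Reasoning
-- plug=named holds for values as well, so the rule's side condition is not needed.
unlet-BaseC (c-let C {A = A} _) = begin
  unlet (plug C A)
    ≡⟨ unlet-plug C A ⟩
  plug (unletF C) (unlet A)
    ≈⟨ plug=named (unletF C) (unlet A) ⟩
  named (unletF C) (unlet A)
    ≡⟨ cong (λ K → app (lam K) (unlet A)) (unlet-plug-wkF C (var here)) ⟨
  app (lam (unlet (plug (wkF C) (var here)))) (unlet A)
    ∎
  where open =v-Reasoning
unlet-BaseC (c-box r) = v-rule (v-box (unlet-BoxRule r))

mutual
  unlet-→c : {P Q : Tm true Γ σ} → P →c Q → unlet P =v unlet Q
  unlet-→c (step r) = unlet-BaseC r
  unlet-→c (lamC p) = gmap lam lamC (unlet-→c p)
  unlet-→c (appLC {N = N} p) = gmap (λ M → app M (unlet N)) appLC (unlet-→c p)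
  unlet-→c (appRC {M = M} p) = gmap (app (unlet M)) appRC (unlet-→c p)
  unlet-→c (boxAC {M = M} p) = gmap (λ as → box as (unlet M)) boxAC (unletArgs-CompArgs p)
  unlet-→c (boxBC {as = as} p) = gmap (box (unletArgs as)) boxBC (unlet-→c p)
  unlet-→c (let1C {N = N} p) = gmap (app (lam (unlet N))) appRC (unlet-→c p)
  unlet-→c (let2C {M = M} p) = gmap (λ N → app (lam N) (unlet M)) (appLC ∘′ lamC) (unlet-→c p)

  unletArgs-CompArgs : {as as' : Args true Γ Ξ} → CompArgs BaseC as as' →
                       EqClosure (CompArgs BaseV) (unletArgs as) (unletArgs as')
  unletArgs-CompArgs (hd {as = as} p) = gmap (_∷ unletArgs as) hd (unlet-→c p)
  unletArgs-CompArgs (tl {a = a} p) = gmap (unlet a ∷_) tl (unletArgs-CompArgs p)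

proposition10 : ∀ {Γ σ} (M N : Tm false Γ σ) → (M =v N) ⇔ (emb M =c emb N)
proposition10 M N = mk⇔
  (gfold (isEquivalence _) emb emb-→v)
  (λ e → subst₂ _=v_ (unlet-emb M) (unlet-emb N) (gfold (isEquivalence _) unlet unlet-→c e))
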